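{- Let $S\subset\{0,1\}^n$ with $|S|=2^{n-1}$. If there is a half plane $H$ with $|S\cap H|\le 2^{n-3}$, then $\mathrm{Type}(S)=|S\cap H|$.
   Context: A half plane of the hypercube $\{0,1\}^n$ is a set $\{x\in\{0,1\}^n: x_i=a\}$ for some $1\le i\le n$, $a\in\{0,1\}$. For $S\subset\{0,1\}^n$, $\mathrm{Type}(S)=\min_H|S\cap H|$ over all $2n$ half planes $H$. -}

module Defs where

open import Data.Bool using (Bool; true; false)
open import Data.Bool.Properties using (_≟_)
open import Data.Nat using (ℕ; _⊓_; _^_)
open import Data.Fin using (Fin)
open import Data.Vec using (Vec; lookup)
open import Data.List using (List; []; _∷_; length; filter; map; concatMap; allFin; foldr)
open import Data.Product using (_×_; _,_)
open import Relation.Nullary using (Dec)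
open import Relation.Binary.PropositionalEquality using (_≡_)

-- A point of the hypercube {0,1}^n (false = 0, true = 1).
Point : ℕ → Set
Point n = Vec Bool n

-- A half plane {x : x_i = a} is given by the pair (i , a).
HalfPlane : ℕ → Set
HalfPlane n = Fin n × Bool

inHalfPlane? : ∀ {n} (h : HalfPlane n) (x : Point n) → Dec (lookup x (Data.Product.proj₁ h) ≡ Data.Product.proj₂ h)
inHalfPlane? (i , a) x = lookup x i ≟ a

-- |S ∩ H| for S given as a duplicate-free list of points.
interCount : ∀ {n} → List (Point n) → HalfPlane n → ℕ
interCount S h = length (filter (inHalfPlane? h) S)

allHalfPlanes : (n : ℕ) → List (HalfPlane n)
allHalfPlanes n = concatMap (λ i → (i , false) ∷ (i , true) ∷ []) (allFin n)

-- Type(S) = min over all half planes H of |S ∩ H|.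
-- (For n = 0 there are no half planes; the default value 2^0 is then
-- returned, but this case never arises in the theorem.)
Type : ∀ {n} → List (Point n) → ℕ
Type {n} S = foldr (λ h m → interCount S h ⊓ m) (2 ^ n) (allHalfPlanes n)

-- A half plane H with 8|S ∩ H| ≤ 2^n is beaten by no other half plane H'.
-- If H' is the opposite half of the same coordinate, S ⊆ H ∪ H' gives
-- |S ∩ H'| ≥ 2^(n-1) − |S ∩ H|. Otherwise S ⊆ H ∪ H' ∪ Q where Q is the
-- codimension-two subcube opposite to both, which holds at most 2^(n-2)
-- points of S; so |S ∩ H'| ≥ 2^(n-2) − |S ∩ H| ≥ |S ∩ H| in either case.
module Submission where

open import Defs
open import Data.Nat using (ℕ; _≤_; _^_; _*_)
open import Data.List using (List; length)
open import Data.List.Relation.Unary.Unique.Propositional using (Unique)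
open import Relation.Binary.PropositionalEquality using (_≡_)

open import Level using (0ℓ)
open import Data.Nat using (zero; suc; _+_; _⊓_; z≤n; s≤s)
open import Data.Nat.Properties
open import Data.Bool using (Bool; true; false; not)
open import Data.Bool.Properties using (¬-not) renaming (_≟_ to _≟ᵇ_)
open import Data.Fin using (Fin; zero; suc; punchOut) renaming (_≟_ to _≟ᶠ_)
open import Data.Vec using (Vec; []; _∷_; lookup; removeAt; insertAt)
open import Data.Vec.Properties using (insertAt-removeAt; removeAt-punchOut)
open import Data.List using ([]; _∷_; filter; map; foldr)
open import Data.List.Properties using (length-map; filter-all)
open import Data.List.Relation.Unary.All using (All; []; _∷_)
import Data.List.Relation.Unary.All as All
open import Data.List.Relation.Unary.All.Properties using (all-filter)
import Data.List.Relation.Unary.All.Properties as All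
open import Data.List.Relation.Unary.AllPairs using ([]; _∷_)
import Data.List.Relation.Unary.Unique.Propositional.Properties as Unique
open import Data.List.Membership.Propositional using (_∈_)
open import Data.List.Membership.Propositional.Properties using (∈-map⁺; ∈-allFin; ∈-concat⁺′)
open import Data.List.Relation.Unary.Any using (here; there)
open import Data.Product using (_×_; _,_; proj₁)
open import Data.Sum using (_⊎_; inj₁; inj₂; [_,_])
open import Data.Empty using (⊥-elim)
open import Relation.Nullary using (yes; no; contradiction)
open import Relation.Nullary.Decidable using (_×-dec_)
open import Relation.Unary using (Pred; Decidable; _⊆_; _∪_; U)
open import Relation.Unary.Properties using (U?)
open import Relation.Binary.PropositionalEquality using (refl; sym; trans; cong; cong₂; subst; _≢_; module ≡-Reasoning)

private
  variable
    A B : Set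
    n : ℕ

length-filter-∪ : {P Q R : Pred A 0ℓ} (P? : Decidable P) (Q? : Decidable Q) (R? : Decidable R) →
                  R ⊆ P ∪ Q → ∀ xs →
                  length (filter R? xs) ≤ length (filter P? xs) + length (filter Q? xs)
length-filter-∪ P? Q? R? R⊆P∪Q [] = z≤n
length-filter-∪ P? Q? R? R⊆P∪Q (x ∷ xs)
  with ih ← length-filter-∪ P? Q? R? R⊆P∪Q xs | R? x | P? x | Q? x
... | no _   | no _   | no _   = ih
... | no _   | no _   | yes _  = ≤-trans ih (+-monoʳ-≤ _ (n≤1+n _))
... | no _   | yes _  | no _   = m≤n⇒m≤1+n ih
... | no _   | yes _  | yes _  = m≤n⇒m≤1+n (≤-trans ih (+-monoʳ-≤ _ (n≤1+n _)))
... | yes rx | no ¬px | no ¬qx = ⊥-elim ([ ¬px , ¬qx ] (R⊆P∪Q rx))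
... | yes _  | no _   | yes _  = ≤-trans (s≤s ih) (≤-reflexive (sym (+-suc _ _)))
... | yes _  | yes _  | no _   = s≤s ih
... | yes _  | yes _  | yes _  = s≤s (≤-trans ih (+-monoʳ-≤ _ (n≤1+n _)))

length≤length-filter-∪ : {P Q : Pred A 0ℓ} (P? : Decidable P) (Q? : Decidable Q) →
                         (∀ x → P x ⊎ Q x) → ∀ xs →
                         length xs ≤ length (filter P? xs) + length (filter Q? xs)
length≤length-filter-∪ P? Q? P∪Q xs =
  subst (_≤ length (filter P? xs) + length (filter Q? xs))
        (cong length (filter-all U? (All.universal-U xs)))
        (length-filter-∪ P? Q? U? (λ {x} _ → P∪Q x) xs)

Unique-map⁺-on : {P : Pred A 0ℓ} (f : A → B) →
                 (∀ {x y} → P x → P y → f x ≡ f y → x ≡ y) →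
                 ∀ {xs} → All P xs → Unique xs → Unique (map f xs)
Unique-map⁺-on f inj []         []           = []
Unique-map⁺-on f inj (px ∷ pxs) (x∉xs ∷ xs!) =
  All.map⁺ (All.zipWith (λ (x≢y , py) fx≡fy → x≢y (inj px py fx≡fy)) (x∉xs , pxs))
  ∷ Unique-map⁺-on f inj pxs xs!

removeAt-injective : (i : Fin (suc n)) {x y : Vec A (suc n)} →
                     lookup x i ≡ lookup y i → removeAt x i ≡ removeAt y i → x ≡ y
removeAt-injective i {x} {y} xᵢ≡yᵢ x⁻≡y⁻ = begin
  x                                       ≡⟨ sym (insertAt-removeAt x i) ⟩
  insertAt (removeAt x i) i (lookup x i)  ≡⟨ cong₂ (λ v c → insertAt v i c) x⁻≡y⁻ xᵢ≡yᵢ ⟩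
  insertAt (removeAt y i) i (lookup y i)  ≡⟨ insertAt-removeAt y i ⟩
  y                                       ∎
  where open ≡-Reasoning

Unique-map-removeAt : (i : Fin (suc n)) {c : A} {xs : List (Vec A (suc n))} →
                      All (λ x → lookup x i ≡ c) xs → Unique xs →
                      Unique (map (λ x → removeAt x i) xs)
Unique-map-removeAt i =
  Unique-map⁺-on (λ x → removeAt x i) (λ xᵢ≡c yᵢ≡c → removeAt-injective i (trans xᵢ≡c (sym yᵢ≡c)))

length≤interCount-opposite : (S : List (Point n)) (i : Fin n) (a : Bool) →
                             length S ≤ interCount S (i , a) + interCount S (i , not a)
length≤interCount-opposite S i a = length≤length-filter-∪ _ _ a-or-not-a S
  where
  a-or-not-a : ∀ x → lookup x i ≡ a ⊎ lookup x i ≡ not a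
  a-or-not-a x with lookup x i ≟ᵇ a
  ... | yes xᵢ≡a = inj₁ xᵢ≡a
  ... | no  xᵢ≢a = inj₂ (¬-not xᵢ≢a)

mutual
  Unique⇒length≤2^ : (xs : List (Point n)) → Unique xs → length xs ≤ 2 ^ n
  Unique⇒length≤2^ {zero}  []               _                 = z≤n
  Unique⇒length≤2^ {zero}  ([] ∷ [])        _                 = ≤-refl
  Unique⇒length≤2^ {zero}  ([] ∷ [] ∷ _)    (([]≢[] ∷ _) ∷ _) = contradiction refl []≢[]
  Unique⇒length≤2^ {suc n} xs xs! = begin
    length xs                                                  ≤⟨ length≤interCount-opposite xs zero true ⟩
    interCount xs (zero , true) + interCount xs (zero , false) ≤⟨ +-mono-≤ (interCount≤2^ xs! (zero , true))
                                                                           (interCount≤2^ xs! (zero , false)) ⟩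
    2 ^ n + 2 ^ n                                              ≡⟨ cong (2 ^ n +_) (+-identityʳ (2 ^ n)) ⟨
    2 ^ suc n                                                  ∎
    where open ≤-Reasoning

  fiber-length≤2^ : (i : Fin (suc n)) {c : Bool} {xs : List (Point (suc n))} →
                    All (λ x → lookup x i ≡ c) xs → Unique xs → length xs ≤ 2 ^ n
  fiber-length≤2^ i {xs = xs} xsᵢ≡c xs! =
    subst (_≤ _) (length-map _ xs) (Unique⇒length≤2^ _ (Unique-map-removeAt i xsᵢ≡c xs!))

  interCount≤2^ : {S : List (Point (suc n))} → Unique S → (H : HalfPlane (suc n)) → interCount S H ≤ 2 ^ n
  interCount≤2^ {S = S} S! (i , c) =
    fiber-length≤2^ i (all-filter (inHalfPlane? (i , c)) S) (Unique.filter⁺ (inHalfPlane? (i , c)) S!)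

Quadrant : Fin n → Bool → Fin n → Bool → Pred (Point n) 0ℓ
Quadrant i a j b x = lookup x i ≡ a × lookup x j ≡ b

quadrant? : (i : Fin n) (a : Bool) (j : Fin n) (b : Bool) → Decidable (Quadrant i a j b)
quadrant? i a j b x = (lookup x i ≟ᵇ a) ×-dec (lookup x j ≟ᵇ b)

quadrant-length≤2^ : {i j : Fin n} → i ≢ j → {a b : Bool} {xs : List (Point n)} →
                     All (Quadrant i a j b) xs → Unique xs → 4 * length xs ≤ 2 ^ n
quadrant-length≤2^ {suc zero}    {zero} {zero} i≢j _ _ = contradiction refl i≢j
quadrant-length≤2^ {suc (suc m)} {i}    {j}    i≢j {a} {b} {xs} xs∈Q xs! = begin
  4 * length xs             ≡⟨ cong (4 *_) (sym (length-map _ xs)) ⟩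
  4 * length xs⁻            ≤⟨ *-monoʳ-≤ 4 (fiber-length≤2^ (punchOut i≢j) xs⁻ⱼ≡b xs⁻!) ⟩
  4 * 2 ^ m                 ≡⟨ *-assoc 2 2 (2 ^ m) ⟩
  2 ^ suc (suc m)           ∎
  where
  open ≤-Reasoning
  xs⁻ : List (Point (suc m))
  xs⁻ = map (λ x → removeAt x i) xs
  xs⁻! : Unique xs⁻
  xs⁻! = Unique-map-removeAt i (All.map proj₁ xs∈Q) xs!
  xs⁻ⱼ≡b : All (λ y → lookup y (punchOut i≢j) ≡ b) xs⁻
  xs⁻ⱼ≡b = All.map⁺ (All.map (λ {x} (_ , xⱼ≡b) → trans (removeAt-punchOut x i≢j) xⱼ≡b) xs∈Q)

interCount-opposite≤ : (S : List (Point n)) (i j : Fin n) (a b : Bool) →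
                       interCount S (i , not a) ≤
                       interCount S (j , b) + length (filter (quadrant? i (not a) j (not b)) S)
interCount-opposite≤ S i j a b =
  length-filter-∪ (inHalfPlane? (j , b)) (quadrant? i (not a) j (not b)) (inHalfPlane? (i , not a))
                  (λ {x} → b-or-quadrant x) S
  where
  b-or-quadrant : ∀ x → lookup x i ≡ not a → lookup x j ≡ b ⊎ Quadrant i (not a) j (not b) x
  b-or-quadrant x xᵢ≡¬a with lookup x j ≟ᵇ b
  ... | yes xⱼ≡b = inj₁ xⱼ≡b
  ... | no  xⱼ≢b = inj₂ (xᵢ≡¬a , ¬-not xⱼ≢b)

≤-from-cover : ∀ {s k c f N} → 2 * s ≡ N → 8 * k ≤ N → 4 * f ≤ N → s ≤ k + c + f → k ≤ c
≤-from-cover {s} {k} {c} {f} {N} 2s≡N 8k≤N 4f≤N s≤k+c+f =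
  *-cancelˡ-≤ 4 (+-cancelˡ-≤ (4 * k) _ _ (≤-trans (≤-reflexive (sym (*-distribʳ-+ k 4 4))) 8k≤4k+4c))
  where
  open ≤-Reasoning
  2N≤4k+4c+N : N + N ≤ (4 * k + 4 * c) + N
  2N≤4k+4c+N = begin
    N + N                    ≡⟨ cong (λ m → m + m) (sym 2s≡N) ⟩
    2 * s + 2 * s            ≡⟨ *-distribʳ-+ s 2 2 ⟨
    4 * s                    ≤⟨ *-monoʳ-≤ 4 s≤k+c+f ⟩
    4 * (k + c + f)          ≡⟨ *-distribˡ-+ 4 (k + c) f ⟩
    4 * (k + c) + 4 * f      ≡⟨ cong (_+ 4 * f) (*-distribˡ-+ 4 k c) ⟩
    (4 * k + 4 * c) + 4 * f  ≤⟨ +-monoʳ-≤ (4 * k + 4 * c) 4f≤N ⟩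
    (4 * k + 4 * c) + N      ∎
  8k≤4k+4c : 8 * k ≤ 4 * k + 4 * c
  8k≤4k+4c = ≤-trans 8k≤N (+-cancelʳ-≤ N N _ 2N≤4k+4c+N)

foldr-⊓-≤ : (f : A → ℕ) (e : ℕ) {x : A} {xs : List A} → x ∈ xs → foldr (λ y m → f y ⊓ m) e xs ≤ f x
foldr-⊓-≤ f e (here refl) = m⊓n≤m _ _
foldr-⊓-≤ f e (there x∈xs) = ≤-trans (m⊓n≤n _ _) (foldr-⊓-≤ f e x∈xs)

≤-foldr-⊓ : (f : A → ℕ) {e k : ℕ} → k ≤ e → (∀ x → k ≤ f x) → ∀ xs → k ≤ foldr (λ y m → f y ⊓ m) e xs
≤-foldr-⊓ f k≤e k≤f []       = k≤e
≤-foldr-⊓ f k≤e k≤f (x ∷ xs) = ⊓-glb (k≤f x) (≤-foldr-⊓ f k≤e k≤f xs)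

∈-allHalfPlanes : (H : HalfPlane n) → H ∈ allHalfPlanes n
∈-allHalfPlanes (i , a) = ∈-concat⁺′ (a∈pair a) (∈-map⁺ (λ i → (i , false) ∷ (i , true) ∷ []) (∈-allFin i))
  where
  a∈pair : ∀ a → (i , a) ∈ (i , false) ∷ (i , true) ∷ []
  a∈pair false = here refl
  a∈pair true  = there (here refl)

Type≤interCount : (S : List (Point n)) (H : HalfPlane n) → Type S ≤ interCount S H
Type≤interCount S H = foldr-⊓-≤ (interCount S) _ (∈-allHalfPlanes H)

≤-Type : (S : List (Point n)) {k : ℕ} → k ≤ 2 ^ n → (∀ H → k ≤ interCount S H) → k ≤ Type S
≤-Type {n} S k≤2ⁿ k≤S∩H = ≤-foldr-⊓ (interCount S) k≤2ⁿ k≤S∩H (allHalfPlanes n)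

small-interCount-minimal : {S : List (Point n)} → Unique S → 2 * length S ≡ 2 ^ n →
                           (H : HalfPlane n) → 8 * interCount S H ≤ 2 ^ n →
                           (H′ : HalfPlane n) → interCount S H ≤ interCount S H′
small-interCount-minimal {S = S} S! 2|S|≡2ⁿ (i , a) small (j , b) with i ≟ᶠ j | b ≟ᵇ a
... | yes refl | yes refl = ≤-refl
... | yes refl | no b≢a   = ≤-from-cover {f = 0} 2|S|≡2ⁿ small z≤n (begin
  length S                                            ≤⟨ length≤interCount-opposite S i a ⟩
  interCount S (i , a) + interCount S (i , not a)     ≡⟨ cong (λ c → _ + interCount S (i , c)) (¬-not b≢a) ⟨
  interCount S (i , a) + interCount S (i , b)         ≤⟨ m≤m+n _ 0 ⟩
  interCount S (i , a) + interCount S (i , b) + 0     ∎)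
  where open ≤-Reasoning
... | no i≢j   | _        =
  ≤-from-cover 2|S|≡2ⁿ small (quadrant-length≤2^ i≢j (all-filter Q? S) (Unique.filter⁺ Q? S!)) (begin
  length S                                            ≤⟨ length≤interCount-opposite S i a ⟩
  interCount S (i , a) + interCount S (i , not a)     ≤⟨ +-monoʳ-≤ _ (interCount-opposite≤ S i j a b) ⟩
  interCount S (i , a) + (interCount S (j , b) + length (filter Q? S))
                                                      ≡⟨ +-assoc (interCount S (i , a)) _ _ ⟨
  interCount S (i , a) + interCount S (j , b) + length (filter Q? S) ∎)
  where
  open ≤-Reasoning
  Q? : Decidable (Quadrant i (not a) j (not b))
  Q? = quadrant? i (not a) j (not b)

corollary2p4 : (n : ℕ) (S : List (Point n)) → Unique S
    → 2 * length S ≡ 2 ^ n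
    → (H : HalfPlane n) → 8 * interCount S H ≤ 2 ^ n
    → Type S ≡ interCount S H
corollary2p4 n S S! 2|S|≡2ⁿ H small =
  ≤-antisym (Type≤interCount S H)
            (≤-Type S (≤-trans (m≤n*m _ 8) small) (small-interCount-minimal S! 2|S|≡2ⁿ H small))
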